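{- Let $p$ be a prime and $G=\mathbb Z_{p^{a_1}}\times\ldots\times\mathbb Z_{p^{a_r}}$ with $a_1\leq a_2\leq\ldots\leq a_r$, and set $a_0=0$. Then $$\delta(G)=1+\sum_{k=1}^rp^{(r-k)a_{k-1}+(a_1+\ldots+a_{k-1})-1}(p^{r-k+1}-1)[a_k-a_{k-1}]_{p^{r-k}},$$ where $[a]_q=1+q+q^2+\ldots+q^{a-1}$ (so $[0]_q=0$).
   Context: For a finite group $G$, $\delta(G)=\sum_{g\in G}\frac{1}{\mathrm{ord}(g)}$, where $\mathrm{ord}(g)$ is the order of $g$. -}

module Defs where

open import Data.Nat using (ℕ; zero; suc; _+_; _*_; _∸_; _^_)
open import Data.Nat.Divisibility using (_∣?_)
open import Data.Fin using (Fin; toℕ; inject₁) renaming (zero to fzero; suc to fsuc)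
open import Data.List using (List; []; _∷_; map; concatMap; allFin; foldr; length)
open import Data.Bool using (Bool; true; false; if_then_else_)
open import Data.Integer using (+_)
open import Data.Rational using (ℚ; _/_; 0ℚ) renaming (_+_ to _+ℚ_)
open import Relation.Nullary.Decidable using (⌊_⌋)
open import Data.Product using (_,_)

-- The group Z_{N 0} × … × Z_{N (r-1)}: tuples g with g i ∈ Fin (N i) = Z_{N i}.
Tuple : (r : ℕ) → (Fin r → ℕ) → Set
Tuple r N = (i : Fin r) → Fin (N i)

cons : ∀ {r} {N : Fin (suc r) → ℕ} → Fin (N fzero) → Tuple r (λ i → N (fsuc i)) → Tuple (suc r) N
cons x g fzero = x
cons x g (fsuc i) = g i

allTuples : (r : ℕ) (N : Fin r → ℕ) → List (Tuple r N)
allTuples zero N = (λ ()) ∷ []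
allTuples (suc r) N =
  concatMap (λ x → map (cons x) (allTuples r (λ i → N (fsuc i)))) (allFin (N fzero))

-- Boolean: k·g = 0 in the group, i.e. N i ∣ k * g_i in every coordinate
-- (k·x = 0 in Z_n iff n ∣ k x).
allB : (r : ℕ) → (Fin r → Bool) → Bool
allB zero f = true
allB (suc r) f = if f fzero then allB r (λ i → f (fsuc i)) else false

isZeroMul : (r : ℕ) (N : Fin r → ℕ) → ℕ → Tuple r N → Bool
isZeroMul r N k g = allB r (λ i → ⌊ N i ∣? (k * toℕ (g i)) ⌋)

prodN : (r : ℕ) → (Fin r → ℕ) → ℕ
prodN zero N = 1
prodN (suc r) N = N fzero * prodN r (λ i → N (fsuc i))

-- searchPred P m f: returns m' such that suc m' is the least k ≥ suc m with P k
-- (searching at most f steps).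
searchPred : (ℕ → Bool) → ℕ → ℕ → ℕ
searchPred P m zero = m
searchPred P m (suc f) = if P (suc m) then m else searchPred P (suc m) f

-- ord g = least positive k with k·g = 0  (which is ≤ |G|, so the search bound |G| suffices)
ord : (r : ℕ) (N : Fin r → ℕ) → Tuple r N → ℕ
ord r N g = suc (searchPred (λ k → isZeroMul r N k g) 0 (prodN r N))

sumℚ : List ℚ → ℚ
sumℚ = foldr _+ℚ_ 0ℚ

δ : (r : ℕ) (N : Fin r → ℕ) → ℚ
δ r N = sumℚ (map (λ g → (+ 1) / ord r N g) (allTuples r N))

qint : ℕ → ℕ → ℕ
qint zero q = 0
qint (suc a) q = qint a q + q ^ a

sumBelow : (r : ℕ) → (Fin r → ℕ) → ℕ → ℕ
sumBelow zero f k = 0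
sumBelow (suc r) f zero = 0
sumBelow (suc r) f (suc k) = f fzero + sumBelow r (λ i → f (fsuc i)) k

-- a_{k-1} for 0-based index k' = k-1 (paper's k = k'+1), with a_0 = 0
prevA : (r : ℕ) → (Fin r → ℕ) → Fin r → ℕ
prevA (suc r) a fzero = 0
prevA (suc r) a (fsuc i) = a (inject₁ i)

sumFinℚ : (r : ℕ) → (Fin r → ℚ) → ℚ
sumFinℚ r f = sumℚ (map f (allFin r))

-- The order of every g ∈ G = ℤ/p^a₁ × ⋯ × ℤ/p^aᵣ is a power p^m(g), and p^j·g = 0 exactly when m(g) ≤ j.
-- Expanding p^(-m) = [m = 0] + Σ_{j<A} [m = j + 1] p^(-(j+1)) and summing over G gives
-- δ(G) = 1 + Σ_{j<A} (|G[p^(j+1)]| − |G[p^j]|) / p^(j+1), where the p^j-torsion subgroup G[p^j] has order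
-- p^(Σᵢ min(aᵢ, j)). For a_(k-1) ≤ j ≤ a_k this exponent is a₁ + ⋯ + a_(k-1) + (r − k + 1) j, so the layers
-- j ∈ [a_(k-1), a_k) form a geometric sum with ratio p^(r−k), which is the k-th term of the formula.

module Submission where

open import Defs

open import Algebra.Bundles using (CommutativeMonoid)
import Algebra.Properties.CommutativeSemigroup as CommutativeSemigroupProperties
open import Data.Bool using (Bool; true; false; if_then_else_; _∧_; not)
open import Data.Bool.Properties using (T-≡; ¬-not)
open import Data.Empty using (⊥-elim)
open import Data.Fin using (Fin; toℕ; inject₁; fromℕ) renaming (zero to fzero; suc to fsuc; _≤_ to _≤ᶠ_)
open import Data.Fin.Properties using (toℕ<n; toℕ-inject₁; ≤fromℕ)
open import Data.Integer using (+_) renaming (_+_ to _+ℤ_; _*_ to _*ℤ_)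
import Data.Integer.Properties as ℤ
import Data.Integer.Tactic.RingSolver as ℤ-Solver
open import Data.List using (List; []; _∷_; _++_; map; concatMap; allFin; tabulate)
open import Data.List.Properties using (map-tabulate)
open import Data.Nat as ℕ
  using (ℕ; zero; suc; _+_; _*_; _∸_; _^_; _⊓_; _%_; _≤_; _<_; z≤n; s≤s; s≤s⁻¹; z<s;
         NonZero; NonTrivial; nonTrivial⇒n>1; nonTrivial⇒nonZero)
open import Data.Nat.Properties
open import Data.Nat.DivMod using (m≡m%n+[m/n]*n; m%n<n)
open import Data.Nat.Divisibility
  using (_∣_; _∣?_; divides; _∣0; ∣-refl; ∣⇒≤; ∣1⇒≡1; ∣m∣n⇒∣m+n; ∣m+n∣m⇒∣n; m∣m*n; ∣m⇒∣m*n; ∣n⇒∣m*n;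
         *-monoʳ-∣; *-cancelˡ-∣; m%n≡0⇒n∣m)
open import Data.Nat.Coprimality using (Coprime; coprime-divisor)
open import Data.Nat.Primality using (Prime; prime⇒nonZero; prime⇒irreducible; prime⇒nonTrivial)
open import Data.Nat.Tactic.RingSolver using (solve-∀)
open import Data.Product using (∃; _×_; _,_; proj₁; proj₂)
open import Data.Rational using (ℚ; _/_; 0ℚ; 1ℚ; fromℚᵘ) renaming (_+_ to _+ℚ_)
import Data.Rational.Properties as ℚ
open import Data.Rational.Unnormalised using (mkℚᵘ; *≡*) renaming (_+_ to _+ᵘ_)
import Data.Rational.Unnormalised.Properties as ℚᵘ
open import Data.Sum using (inj₁; inj₂)
import Data.Vec.Functional as Vector
open import Function using (id; _∘_; mk⇔; Equivalence)
open import Relation.Binary.PropositionalEquality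
open import Relation.Binary.Definitions using (tri<; tri≈; tri>)
open import Relation.Nullary using (Dec; does; yes; no; ¬_)
open import Relation.Nullary.Decidable using (⌊_⌋; isYes≗does; dec-true; dec-false; does-⇔; toWitness)

private
  variable
    A B C : Set

  true≢false : true ≢ false
  true≢false ()

  if-then-else-false : ∀ u v → (if u then v else false) ≡ u ∧ v
  if-then-else-false true v = refl
  if-then-else-false false v = refl

indicator : Bool → ℕ
indicator true = 1
indicator false = 0

count : (A → Bool) → List A → ℕ
count b [] = 0
count b (x ∷ xs) = indicator (b x) + count b xs

count-cong : {b c : A → Bool} → (∀ x → b x ≡ c x) → ∀ xs → count b xs ≡ count c xs
count-cong b≗c [] = refl
count-cong b≗c (x ∷ xs) = cong₂ _+_ (cong indicator (b≗c x)) (count-cong b≗c xs)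

count-++ : (b : A → Bool) (xs ys : List A) → count b (xs ++ ys) ≡ count b xs + count b ys
count-++ b [] ys = refl
count-++ b (x ∷ xs) ys =
  trans (cong (_+_ (indicator (b x))) (count-++ b xs ys)) (sym (+-assoc (indicator (b x)) _ _))

indicator-∧ : ∀ u v → indicator (u ∧ v) ≡ indicator u * indicator v
indicator-∧ true v = sym (+-identityʳ (indicator v))
indicator-∧ false v = refl

count-concatMap-∧ : (b : A → Bool) (c : B → Bool) (h : C → Bool) (f : A → B → C) →
  (∀ x y → h (f x y) ≡ b x ∧ c y) →
  ∀ xs ys → count h (concatMap (λ x → map (f x) ys) xs) ≡ count b xs * count c ys
count-concatMap-∧ b c h f h≗∧ [] ys = refl
count-concatMap-∧ b c h f h≗∧ (x ∷ xs) ys = begin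
  count h (map (f x) ys ++ concatMap (λ x → map (f x) ys) xs)
    ≡⟨ count-++ h (map (f x) ys) _ ⟩
  count h (map (f x) ys) + count h (concatMap (λ x → map (f x) ys) xs)
    ≡⟨ cong₂ _+_ (row ys) (count-concatMap-∧ b c h f h≗∧ xs ys) ⟩
  indicator (b x) * count c ys + count b xs * count c ys
    ≡⟨ *-distribʳ-+ (count c ys) (indicator (b x)) (count b xs) ⟨
  (indicator (b x) + count b xs) * count c ys ∎
  where
  open ≡-Reasoning
  row : ∀ zs → count h (map (f x) zs) ≡ indicator (b x) * count c zs
  row [] = sym (*-zeroʳ (indicator (b x)))
  row (y ∷ zs) = begin
    indicator (h (f x y)) + count h (map (f x) zs)
      ≡⟨ cong₂ _+_ (trans (cong indicator (h≗∧ x y)) (indicator-∧ (b x) (c y))) (row zs) ⟩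
    indicator (b x) * indicator (c y) + indicator (b x) * count c zs
      ≡⟨ *-distribˡ-+ (indicator (b x)) (indicator (c y)) (count c zs) ⟨
    indicator (b x) * (indicator (c y) + count c zs) ∎

ℕ-interchange : ∀ a b c d → (a + b) + (c + d) ≡ (a + c) + (b + d)
ℕ-interchange = CommutativeSemigroupProperties.interchange +-commutativeSemigroup

indicator-+-cong : ∀ {u v w u′ v′ w′} → u ≡ u′ → v ≡ v′ → w ≡ w′ →
  indicator u′ + indicator v′ ≡ indicator w′ → indicator u + indicator v ≡ indicator w
indicator-+-cong refl refl refl eq = eq

indicator-≟-suc : ∀ m j →
  indicator (does (m ≟ suc j)) + indicator (does (m ≤? j)) ≡ indicator (does (m ≤? suc j))
indicator-≟-suc m j with <-cmp m (suc j)
... | tri< m<1+j m≢1+j _ = indicator-+-cong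
  (dec-false (m ≟ suc j) m≢1+j) (dec-true (m ≤? j) (s≤s⁻¹ m<1+j)) (dec-true (m ≤? suc j) (<⇒≤ m<1+j)) refl
... | tri≈ _ refl _ = indicator-+-cong
  (dec-true (m ≟ m) refl) (dec-false (m ≤? j) (1+n≰n {j})) (dec-true (m ≤? m) ≤-refl) refl
... | tri> _ m≢1+j 1+j<m = indicator-+-cong
  (dec-false (m ≟ suc j) m≢1+j) (dec-false (m ≤? j) (<⇒≱ (<-trans (n<1+n j) 1+j<m)))
  (dec-false (m ≤? suc j) (<⇒≱ 1+j<m)) refl

count-≟-suc : (f : A → ℕ) (j : ℕ) (xs : List A) →
  count (λ x → does (f x ≟ suc j)) xs + count (λ x → does (f x ≤? j)) xs ≡
  count (λ x → does (f x ≤? suc j)) xs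
count-≟-suc f j [] = refl
count-≟-suc f j (x ∷ xs) =
  trans (ℕ-interchange (indicator (does (f x ≟ suc j))) _ (indicator (does (f x ≤? j))) _)
        (cong₂ _+_ (indicator-≟-suc (f x) j) (count-≟-suc f j xs))

countBelow : (ℕ → Bool) → ℕ → ℕ
countBelow Q zero = 0
countBelow Q (suc n) = indicator (Q 0) + countBelow (Q ∘ suc) n

count-tabulate : ∀ n (f : Fin n → A) (b : A → Bool) (Q : ℕ → Bool) →
  (∀ i → b (f i) ≡ Q (toℕ i)) → count b (tabulate f) ≡ countBelow Q n
count-tabulate zero f b Q b∘f≗Q = refl
count-tabulate (suc n) f b Q b∘f≗Q =
  cong₂ _+_ (cong indicator (b∘f≗Q fzero)) (count-tabulate n (f ∘ fsuc) b (Q ∘ suc) (b∘f≗Q ∘ fsuc))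

countBelow-cong : ∀ n {Q R : ℕ → Bool} → (∀ x → Q x ≡ R x) → countBelow Q n ≡ countBelow R n
countBelow-cong zero Q≗R = refl
countBelow-cong (suc n) Q≗R = cong₂ _+_ (cong indicator (Q≗R 0)) (countBelow-cong n (Q≗R ∘ suc))

countBelow-+ : ∀ m n (Q : ℕ → Bool) →
  countBelow Q (m + n) ≡ countBelow Q m + countBelow (λ x → Q (m + x)) n
countBelow-+ zero n Q = refl
countBelow-+ (suc m) n Q =
  trans (cong (_+_ (indicator (Q 0))) (countBelow-+ m n (Q ∘ suc))) (sym (+-assoc (indicator (Q 0)) _ _))

countBelow-all : ∀ n (Q : ℕ → Bool) → (∀ x → Q x ≡ true) → countBelow Q n ≡ n
countBelow-all zero Q Q≡true = refl
countBelow-all (suc n) Q Q≡true =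
  cong₂ _+_ (cong indicator (Q≡true 0)) (countBelow-all n (Q ∘ suc) (Q≡true ∘ suc))

countBelow-none : ∀ n (Q : ℕ → Bool) → (∀ x → x < n → Q x ≡ false) → countBelow Q n ≡ 0
countBelow-none zero Q Q≡false = refl
countBelow-none (suc n) Q Q≡false =
  cong₂ _+_ (cong indicator (Q≡false 0 z<s))
            (countBelow-none n (Q ∘ suc) (λ x x<n → Q≡false (suc x) (s≤s x<n)))

countBelow-multiples : ∀ d .{{_ : NonZero d}} m → countBelow (λ x → does (d ∣? x)) (m * d) ≡ m
countBelow-multiples d zero = refl
countBelow-multiples d@(suc d-1) (suc m) = begin
  countBelow (λ x → does (d ∣? x)) (d + m * d)
    ≡⟨ countBelow-+ d (m * d) (λ x → does (d ∣? x)) ⟩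
  countBelow (λ x → does (d ∣? x)) d + countBelow (λ x → does (d ∣? d + x)) (m * d)
    ≡⟨ cong₂ _+_ first-period (countBelow-cong (m * d) shift) ⟩
  1 + countBelow (λ x → does (d ∣? x)) (m * d)
    ≡⟨ cong suc (countBelow-multiples d m) ⟩
  suc m ∎
  where
  open ≡-Reasoning
  first-period : countBelow (λ x → does (d ∣? x)) d ≡ 1
  first-period = cong₂ _+_ (cong indicator (dec-true (d ∣? 0) (d ∣0)))
    (countBelow-none d-1 (λ x → does (d ∣? suc x))
      (λ x x<d-1 → dec-false (d ∣? suc x) (λ d∣1+x → <⇒≱ (s≤s x<d-1) (∣⇒≤ d∣1+x))))
  shift : ∀ x → does (d ∣? d + x) ≡ does (d ∣? x)
  shift x = does-⇔ (mk⇔ (λ d∣d+x → ∣m+n∣m⇒∣n d∣d+x ∣-refl) (∣m∣n⇒∣m+n ∣-refl)) (d ∣? d + x) (d ∣? x)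

-- The order of an element

Kills : (r : ℕ) (N : Fin r → ℕ) → ℕ → Tuple r N → Set
Kills r N k g = ∀ i → N i ∣ k * toℕ (g i)

allB-sound : ∀ r (f : Fin r → Bool) → allB r f ≡ true → ∀ i → f i ≡ true
allB-sound (suc r) f all i with f fzero in f₀
allB-sound (suc r) f all fzero | true = f₀
allB-sound (suc r) f all (fsuc i) | true = allB-sound r (f ∘ fsuc) all i
allB-sound (suc r) f () i | false

allB-complete : ∀ r (f : Fin r → Bool) → (∀ i → f i ≡ true) → allB r f ≡ true
allB-complete zero f all = refl
allB-complete (suc r) f all rewrite all fzero = allB-complete r (f ∘ fsuc) (all ∘ fsuc)

module _ {r : ℕ} {N : Fin r → ℕ} where

  isZeroMul⇒Kills : ∀ k g → isZeroMul r N k g ≡ true → Kills r N k g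
  isZeroMul⇒Kills k g k·g≡0 i =
    toWitness (Equivalence.from T-≡ (allB-sound r _ k·g≡0 i))

  Kills⇒isZeroMul : ∀ k g → Kills r N k g → isZeroMul r N k g ≡ true
  Kills⇒isZeroMul k g kills =
    allB-complete r _ λ i → trans (isYes≗does (N i ∣? k * toℕ (g i))) (dec-true (N i ∣? k * toℕ (g i)) (kills i))

searchPred-skips : ∀ (P : ℕ → Bool) m f k → m < k → k ≤ searchPred P m f → P k ≡ false
searchPred-skips P m zero k m<k k≤m = ⊥-elim (<⇒≱ m<k k≤m)
searchPred-skips P m (suc f) k m<k k≤s with P (suc m) in P[1+m]
... | true = ⊥-elim (<⇒≱ m<k k≤s)
... | false with k ≟ suc m
...   | yes refl = P[1+m]
...   | no k≢1+m = searchPred-skips P (suc m) f k (≤∧≢⇒< m<k (k≢1+m ∘ sym)) k≤s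

searchPred-finds : ∀ (P : ℕ → Bool) m f → 0 < f → P (m + f) ≡ true → P (suc (searchPred P m f)) ≡ true
searchPred-finds P m (suc f) _ hit with P (suc m) in P[1+m]
... | true = P[1+m]
searchPred-finds P m (suc zero) _ hit | false =
  ⊥-elim (true≢false (trans (sym hit) (trans (cong P (+-comm m 1)) P[1+m])))
searchPred-finds P m (suc (suc f)) _ hit | false =
  searchPred-finds P (suc m) (suc f) z<s (trans (cong P (sym (+-suc m (suc f)))) hit)

prodN-pos : ∀ r (N : Fin r → ℕ) → (∀ i → 0 < N i) → 0 < prodN r N
prodN-pos zero N N>0 = z<s
prodN-pos (suc r) N N>0 = *-mono-< (N>0 fzero) (prodN-pos r (N ∘ fsuc) (N>0 ∘ fsuc))

∣prodN : ∀ r (N : Fin r → ℕ) i → N i ∣ prodN r N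
∣prodN (suc r) N fzero = m∣m*n _
∣prodN (suc r) N (fsuc i) = ∣n⇒∣m*n (N fzero) (∣prodN r (N ∘ fsuc) i)

module _ {r : ℕ} {N : Fin r → ℕ} (g : Tuple r N) where

  private
    kills? : ℕ → Bool
    kills? k = isZeroMul r N k g

  ord-kills : Kills r N (ord r N g) g
  ord-kills = isZeroMul⇒Kills (ord r N g) g
    (searchPred-finds kills? 0 (prodN r N) (prodN-pos r N N>0) (Kills⇒isZeroMul (prodN r N) g prodN-kills))
    where
    N>0 : ∀ i → 0 < N i
    N>0 i = <-≤-trans z<s (toℕ<n (g i))
    prodN-kills : Kills r N (prodN r N) g
    prodN-kills i = ∣m⇒∣m*n (toℕ (g i)) (∣prodN r N i)

  ord-minimal : ∀ k → 0 < k → k < ord r N g → ¬ Kills r N k g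
  ord-minimal k 0<k k<ord kills =
    true≢false (trans (sym (Kills⇒isZeroMul k g kills))
                      (searchPred-skips kills? 0 (prodN r N) k 0<k (s≤s⁻¹ k<ord)))

  Kills⇒ord∣ : ∀ k → Kills r N k g → ord r N g ∣ k
  Kills⇒ord∣ k kills with k % ord r N g in k%o | m%n<n k (ord r N g)
  ... | zero | _ = m%n≡0⇒n∣m k (ord r N g) k%o
  ... | suc ρ | ρ<o = ⊥-elim (ord-minimal (suc ρ) z<s ρ<o remainder-kills)
    where
    o q : ℕ
    o = ord r N g
    q = k ℕ./ o
    remainder-kills : Kills r N (suc ρ) g
    remainder-kills i =
      ∣m+n∣m⇒∣n (subst (N i ∣_) (division (toℕ (g i))) (kills i)) (∣n⇒∣m*n q (ord-kills i))
      where
      division : ∀ x → k * x ≡ q * (o * x) + suc ρ * x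
      division x = begin
        k * x                  ≡⟨ cong (_* x) (trans (m≡m%n+[m/n]*n k o) (cong (_+ q * o) k%o)) ⟩
        (suc ρ + q * o) * x    ≡⟨ rearrange (suc ρ) q o x ⟩
        q * (o * x) + suc ρ * x ∎
        where
        open ≡-Reasoning
        rearrange : ∀ a q o x → (a + q * o) * x ≡ q * (o * x) + a * x
        rearrange = solve-∀

  ord∣⇒Kills : ∀ k → ord r N g ∣ k → Kills r N k g
  ord∣⇒Kills .(q * ord r N g) (divides q refl) i =
    subst (N i ∣_) (sym (*-assoc q (ord r N g) (toℕ (g i)))) (∣n⇒∣m*n q (ord-kills i))

p^m∣p^n : ∀ p {m n} → m ≤ n → p ^ m ∣ p ^ n
p^m∣p^n p {m} {n} m≤n = divides (p ^ (n ∸ m)) (begin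
  p ^ n                ≡⟨ cong (p ^_) (m+[n∸m]≡n m≤n) ⟨
  p ^ (m + (n ∸ m))    ≡⟨ ^-distribˡ-+-* p m (n ∸ m) ⟩
  p ^ m * p ^ (n ∸ m)  ≡⟨ *-comm (p ^ m) _ ⟩
  p ^ (n ∸ m) * p ^ m  ∎)
  where open ≡-Reasoning

p^m∣p^n⇒m≤n : ∀ p .{{_ : NonTrivial p}} {m n} → p ^ m ∣ p ^ n → m ≤ n
p^m∣p^n⇒m≤n p {m} {n} p^m∣p^n = ≮⇒≥ λ n<m →
  <⇒≱ (^-monoʳ-< p (nonTrivial⇒n>1 p) n<m) (∣⇒≤ {{m^n≢0 p n {{nonTrivial⇒nonZero p}}}} p^m∣p^n)

¬∣⇒coprime : ∀ {p d} → Prime p → ¬ p ∣ d → Coprime d p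
¬∣⇒coprime pp p∤d (i∣d , i∣p) with prime⇒irreducible pp i∣p
... | inj₁ i≡1 = i≡1
... | inj₂ refl = ⊥-elim (p∤d i∣d)

∣p^n⇒≡p^m : ∀ {p} → Prime p → ∀ n {d} → d ∣ p ^ n → ∃ λ m → m ≤ n × d ≡ p ^ m
∣p^n⇒≡p^m pp zero d∣1 = 0 , z≤n , ∣1⇒≡1 d∣1
∣p^n⇒≡p^m {p} pp (suc n) {d} d∣p^[1+n] with p ∣? d
... | no p∤d =
  let m , m≤n , d≡p^m = ∣p^n⇒≡p^m pp n (coprime-divisor (¬∣⇒coprime pp p∤d) d∣p^[1+n])
  in m , m≤n⇒m≤1+n m≤n , d≡p^m
... | yes (divides q refl) =
  let instance _ = prime⇒nonZero pp
      m , m≤n , q≡p^m = ∣p^n⇒≡p^m pp n (*-cancelˡ-∣ p (subst (_∣ p * p ^ n) (*-comm q p) d∣p^[1+n]))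
  in suc m , s≤s m≤n , trans (cong (_* p) q≡p^m) (*-comm (p ^ m) p)

-- The p^j-torsion subgroup of ℤ/p^a₁ × ⋯ × ℤ/p^aᵣ

Σ⊓ : (r : ℕ) → (Fin r → ℕ) → ℕ → ℕ
Σ⊓ zero a j = 0
Σ⊓ (suc r) a j = a fzero ⊓ j + Σ⊓ r (a ∘ fsuc) j

module _ (p : ℕ) .{{_ : NonZero p}} where

  count-torsion-cyclic : ∀ a j → count (λ x → ⌊ p ^ a ∣? p ^ j * toℕ x ⌋) (allFin (p ^ a)) ≡ p ^ (a ⊓ j)
  count-torsion-cyclic a j = trans
    (count-tabulate (p ^ a) id (λ x → ⌊ p ^ a ∣? p ^ j * toℕ x ⌋) Q (λ x → isYes≗does (p ^ a ∣? p ^ j * toℕ x)))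
    (by-cases (a ≤? j))
    where
    Q : ℕ → Bool
    Q x = does (p ^ a ∣? p ^ j * x)
    by-cases : Dec (a ≤ j) → countBelow Q (p ^ a) ≡ p ^ (a ⊓ j)
    by-cases (yes a≤j) = begin
      countBelow Q (p ^ a)
        ≡⟨ countBelow-all (p ^ a) Q (λ x → dec-true (p ^ a ∣? p ^ j * x) (∣m⇒∣m*n x (p^m∣p^n p a≤j))) ⟩
      p ^ a
        ≡⟨ cong (p ^_) (m≤n⇒m⊓n≡m a≤j) ⟨
      p ^ (a ⊓ j) ∎
      where open ≡-Reasoning
    by-cases (no a≰j) = begin
      countBelow Q (p ^ a)
        ≡⟨ cong (countBelow Q) p^a≡p^j*p^e ⟩
      countBelow Q (p ^ j * p ^ e)
        ≡⟨ countBelow-cong (p ^ j * p ^ e) Q≗p^e∣ ⟩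
      countBelow (λ x → does (p ^ e ∣? x)) (p ^ j * p ^ e)
        ≡⟨ countBelow-multiples (p ^ e) {{m^n≢0 p e}} (p ^ j) ⟩
      p ^ j
        ≡⟨ cong (p ^_) (m≥n⇒m⊓n≡n j≤a) ⟨
      p ^ (a ⊓ j) ∎
      where
      open ≡-Reasoning
      j≤a : j ≤ a
      j≤a = <⇒≤ (≰⇒> a≰j)
      e : ℕ
      e = a ∸ j
      p^a≡p^j*p^e : p ^ a ≡ p ^ j * p ^ e
      p^a≡p^j*p^e = trans (cong (p ^_) (sym (m+[n∸m]≡n j≤a))) (^-distribˡ-+-* p j e)
      Q≗p^e∣ : ∀ x → Q x ≡ does (p ^ e ∣? x)
      Q≗p^e∣ x = does-⇔
        (mk⇔ (λ p^a∣p^j*x → *-cancelˡ-∣ (p ^ j) {{m^n≢0 p j}} (subst (_∣ p ^ j * x) p^a≡p^j*p^e p^a∣p^j*x))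
             (λ p^e∣x → subst (_∣ p ^ j * x) (sym p^a≡p^j*p^e) (*-monoʳ-∣ (p ^ j) p^e∣x)))
        (p ^ a ∣? p ^ j * x) (p ^ e ∣? x)

  count-torsion : ∀ r (a : Fin r → ℕ) j →
    count (isZeroMul r (λ i → p ^ a i) (p ^ j)) (allTuples r (λ i → p ^ a i)) ≡ p ^ Σ⊓ r a j
  count-torsion zero a j = refl
  count-torsion (suc r) a j = begin
    count (isZeroMul (suc r) N (p ^ j)) (allTuples (suc r) N)
      ≡⟨ count-concatMap-∧ first rest (isZeroMul (suc r) N (p ^ j)) cons
           (λ x g → if-then-else-false (first x) (rest g)) (allFin (N fzero)) (allTuples r (N ∘ fsuc)) ⟩
    count first (allFin (N fzero)) * count rest (allTuples r (N ∘ fsuc))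
      ≡⟨ cong₂ _*_ (count-torsion-cyclic (a fzero) j) (count-torsion r (a ∘ fsuc) j) ⟩
    p ^ (a fzero ⊓ j) * p ^ Σ⊓ r (a ∘ fsuc) j
      ≡⟨ ^-distribˡ-+-* p (a fzero ⊓ j) _ ⟨
    p ^ Σ⊓ (suc r) a j ∎
    where
    open ≡-Reasoning
    N : Fin (suc r) → ℕ
    N i = p ^ a i
    first : Fin (N fzero) → Bool
    first x = ⌊ p ^ a fzero ∣? p ^ j * toℕ x ⌋
    rest : Tuple r (N ∘ fsuc) → Bool
    rest = isZeroMul r (N ∘ fsuc) (p ^ j)

Σ⊓-zero : ∀ r (a : Fin r → ℕ) → Σ⊓ r a 0 ≡ 0
Σ⊓-zero zero a = refl
Σ⊓-zero (suc r) a = cong₂ _+_ (⊓-zeroʳ (a fzero)) (Σ⊓-zero r (a ∘ fsuc))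

Sorted : (r : ℕ) → (Fin r → ℕ) → Set
Sorted r a = ∀ i j → i ≤ᶠ j → a i ≤ a j

Sorted-tail : ∀ {r} {a : Fin (suc r) → ℕ} → Sorted (suc r) a → Sorted r (a ∘ fsuc)
Sorted-tail sorted i j i≤j = sorted (fsuc i) (fsuc j) (s≤s i≤j)

Σ⊓-below : ∀ r (a : Fin r → ℕ) j → (∀ i → j ≤ a i) → Σ⊓ r a j ≡ r * j
Σ⊓-below zero a j _ = refl
Σ⊓-below (suc r) a j j≤a = cong₂ _+_ (m≥n⇒m⊓n≡n (j≤a fzero)) (Σ⊓-below r (a ∘ fsuc) j (j≤a ∘ fsuc))

prevA-tail≤ : ∀ r (a : Fin (suc r) → ℕ) k → prevA r (a ∘ fsuc) k ≤ a (inject₁ k)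
prevA-tail≤ (suc r) a fzero = z≤n
prevA-tail≤ (suc r) a (fsuc k) = ≤-refl

Σ⊓-block : ∀ r (a : Fin r → ℕ) → Sorted r a → ∀ k j → prevA r a k ≤ j → j ≤ a k →
  Σ⊓ r a j ≡ sumBelow r a (toℕ k) + (r ∸ toℕ k) * j
Σ⊓-block (suc r) a sorted fzero j _ j≤a₀ = Σ⊓-below (suc r) a j (λ i → ≤-trans j≤a₀ (sorted fzero i z≤n))
Σ⊓-block (suc r) a sorted (fsuc k) j a[k]≤j j≤a[1+k] = trans
  (cong₂ _+_ (m≤n⇒m⊓n≡m (≤-trans (sorted fzero (inject₁ k) z≤n) a[k]≤j))
             (Σ⊓-block r (a ∘ fsuc) (Sorted-tail sorted) k j
                       (≤-trans (prevA-tail≤ r a k) a[k]≤j) j≤a[1+k]))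
  (sym (+-assoc (a fzero) _ _))

/-cross : ∀ a b d e .{{_ : NonZero d}} .{{_ : NonZero e}} → a * e ≡ b * d → + a / d ≡ + b / e
/-cross a b d@(suc d-1) e@(suc e-1) a*e≡b*d = ℚ.fromℚᵘ-cong {mkℚᵘ (+ a) d-1} {mkℚᵘ (+ b) e-1}
  (*≡* (trans (sym (ℤ.pos-* a e)) (trans (cong +_ a*e≡b*d) (ℤ.pos-* b d))))

fromℚᵘ-homo-+ : ∀ x y → fromℚᵘ x +ℚ fromℚᵘ y ≡ fromℚᵘ (x +ᵘ y)
fromℚᵘ-homo-+ x y = trans (sym (ℚ.fromℚᵘ-toℚᵘ _)) (ℚ.fromℚᵘ-cong
  (ℚᵘ.≃-trans (ℚ.toℚᵘ-homo-+ (fromℚᵘ x) (fromℚᵘ y)) (ℚᵘ.+-cong (ℚ.toℚᵘ-fromℚᵘ x) (ℚ.toℚᵘ-fromℚᵘ y))))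

/-+ : ∀ a b d .{{_ : NonZero d}} → + a / d +ℚ + b / d ≡ + (a + b) / d
/-+ a b d@(suc d-1) = trans (fromℚᵘ-homo-+ (mkℚᵘ (+ a) d-1) (mkℚᵘ (+ b) d-1))
  (ℚ.fromℚᵘ-cong {mkℚᵘ (+ a) d-1 +ᵘ mkℚᵘ (+ b) d-1} {mkℚᵘ (+ (a + b)) d-1} (*≡* cross))
  where
  common-denominator : ∀ x y z → (x *ℤ z +ℤ y *ℤ z) *ℤ z ≡ (x +ℤ y) *ℤ (z *ℤ z)
  common-denominator = ℤ-Solver.solve-∀
  cross : (+ a *ℤ + d +ℤ + b *ℤ + d) *ℤ + d ≡ + (a + b) *ℤ + (d * d)
  cross = trans (common-denominator (+ a) (+ b) (+ d)) (sym (cong₂ _*ℤ_ (ℤ.pos-+ a b) (ℤ.pos-* d d)))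

ℚ-interchange : ∀ a b c d → (a +ℚ b) +ℚ (c +ℚ d) ≡ (a +ℚ c) +ℚ (b +ℚ d)
ℚ-interchange =
  CommutativeSemigroupProperties.interchange (CommutativeMonoid.commutativeSemigroup ℚ.+-0-commutativeMonoid)

sumℚ-cong : {f h : A → ℚ} → (∀ x → f x ≡ h x) → ∀ xs → sumℚ (map f xs) ≡ sumℚ (map h xs)
sumℚ-cong f≗h [] = refl
sumℚ-cong f≗h (x ∷ xs) = cong₂ _+ℚ_ (f≗h x) (sumℚ-cong f≗h xs)

sumℚ-0 : (xs : List A) → sumℚ (map (λ _ → 0ℚ) xs) ≡ 0ℚ
sumℚ-0 [] = refl
sumℚ-0 (x ∷ xs) = trans (cong (0ℚ +ℚ_) (sumℚ-0 xs)) (ℚ.+-identityʳ 0ℚ)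

sumℚ-+ : (f h : A → ℚ) (xs : List A) →
  sumℚ (map (λ x → f x +ℚ h x) xs) ≡ sumℚ (map f xs) +ℚ sumℚ (map h xs)
sumℚ-+ f h [] = sym (ℚ.+-identityʳ 0ℚ)
sumℚ-+ f h (x ∷ xs) =
  trans (cong ((f x +ℚ h x) +ℚ_) (sumℚ-+ f h xs)) (ℚ-interchange (f x) (h x) _ _)

sumℚ-if : (b : A → Bool) (d : ℕ) .{{_ : NonZero d}} (xs : List A) →
  sumℚ (map (λ x → if b x then + 1 / d else 0ℚ) xs) ≡ + count b xs / d
sumℚ-if b d [] = sym (ℚ.0/n≡0 d)
sumℚ-if b d (x ∷ xs) with b x
... | true = trans (cong (+ 1 / d +ℚ_) (sumℚ-if b d xs)) (/-+ 1 (count b xs) d)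
... | false = trans (cong (0ℚ +ℚ_) (sumℚ-if b d xs)) (ℚ.+-identityˡ _)

sumFinℚ-suc : ∀ r (f : Fin (suc r) → ℚ) → sumFinℚ (suc r) f ≡ f fzero +ℚ sumFinℚ r (f ∘ fsuc)
sumFinℚ-suc r f =
  cong (λ xs → f fzero +ℚ sumℚ xs) (trans (map-tabulate fsuc f) (sym (map-tabulate id (f ∘ fsuc))))

sumFrom : (ℕ → ℚ) → ℕ → ℕ → ℚ
sumFrom F x zero = 0ℚ
sumFrom F x (suc L) = sumFrom F x L +ℚ F (x + L)

sumFrom-cong : {F G : ℕ → ℚ} → (∀ j → F j ≡ G j) → ∀ x L → sumFrom F x L ≡ sumFrom G x L
sumFrom-cong F≗G x zero = refl
sumFrom-cong F≗G x (suc L) = cong₂ _+ℚ_ (sumFrom-cong F≗G x L) (F≗G (x + L))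

sumFrom-+ : ∀ F x L M → sumFrom F x (L + M) ≡ sumFrom F x L +ℚ sumFrom F (x + L) M
sumFrom-+ F x L zero = trans (cong (sumFrom F x) (+-identityʳ L)) (sym (ℚ.+-identityʳ _))
sumFrom-+ F x L (suc M) = begin
  sumFrom F x (L + suc M)
    ≡⟨ cong (sumFrom F x) (+-suc L M) ⟩
  sumFrom F x (L + M) +ℚ F (x + (L + M))
    ≡⟨ cong₂ _+ℚ_ (sumFrom-+ F x L M) (cong F (sym (+-assoc x L M))) ⟩
  (sumFrom F x L +ℚ sumFrom F (x + L) M) +ℚ F (x + L + M)
    ≡⟨ ℚ.+-assoc (sumFrom F x L) _ _ ⟩
  sumFrom F x L +ℚ sumFrom F (x + L) (suc M) ∎
  where open ≡-Reasoning

sumFrom-vanish : ∀ F L → (∀ j → j < L → F j ≡ 0ℚ) → sumFrom F 0 L ≡ 0ℚ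
sumFrom-vanish F zero F≡0 = refl
sumFrom-vanish F (suc L) F≡0 =
  trans (cong₂ _+ℚ_ (sumFrom-vanish F L (λ j j<L → F≡0 j (m<n⇒m<1+n j<L))) (F≡0 L (n<1+n L))) (ℚ.+-identityʳ 0ℚ)

sumFrom-point : ∀ F i L → i < L → (∀ j → j ≢ i → F j ≡ 0ℚ) → sumFrom F 0 L ≡ F i
sumFrom-point F i (suc L) i<1+L F≡0 with i ≟ L
... | yes refl =
  trans (cong (_+ℚ F i) (sumFrom-vanish F i (λ j j<i → F≡0 j (<⇒≢ j<i)))) (ℚ.+-identityˡ (F i))
... | no i≢L = trans
  (cong₂ _+ℚ_ (sumFrom-point F i L (≤∧≢⇒< (s≤s⁻¹ i<1+L) i≢L) F≡0) (F≡0 L (i≢L ∘ sym))) (ℚ.+-identityʳ (F i))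

sumℚ-sumFrom : (F : A → ℕ → ℚ) (xs : List A) (L : ℕ) →
  sumℚ (map (λ x → sumFrom (F x) 0 L) xs) ≡ sumFrom (λ j → sumℚ (map (λ x → F x j) xs)) 0 L
sumℚ-sumFrom F xs zero = sumℚ-0 xs
sumℚ-sumFrom F xs (suc L) =
  trans (sumℚ-+ (λ x → sumFrom (F x) 0 L) (λ x → F x L) xs)
        (cong (_+ℚ sumℚ (map (λ x → F x L) xs)) (sumℚ-sumFrom F xs L))

[n∸m]+[o∸n]≡o∸m : ∀ m n o → m ≤ n → n ≤ o → (n ∸ m) + (o ∸ n) ≡ o ∸ m
[n∸m]+[o∸n]≡o∸m zero n o _ n≤o = m+[n∸m]≡n n≤o
[n∸m]+[o∸n]≡o∸m (suc m) (suc n) (suc o) (s≤s m≤n) (s≤s n≤o) = [n∸m]+[o∸n]≡o∸m m n o m≤n n≤o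

sumFrom-telescope : ∀ F r (b : Fin (suc r) → ℕ) → Sorted (suc r) b →
  sumFrom F (b fzero) (b (fromℕ r) ∸ b fzero) ≡
  sumFinℚ r (λ k → sumFrom F (b (inject₁ k)) (b (fsuc k) ∸ b (inject₁ k)))
sumFrom-telescope F zero b sorted = cong (sumFrom F (b fzero)) (n∸n≡0 (b fzero))
sumFrom-telescope F (suc r) b sorted = begin
  sumFrom F b₀ (bₙ ∸ b₀)
    ≡⟨ cong (sumFrom F b₀) ([n∸m]+[o∸n]≡o∸m b₀ b₁ bₙ b₀≤b₁ b₁≤bₙ) ⟨
  sumFrom F b₀ ((b₁ ∸ b₀) + (bₙ ∸ b₁))
    ≡⟨ sumFrom-+ F b₀ (b₁ ∸ b₀) (bₙ ∸ b₁) ⟩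
  sumFrom F b₀ (b₁ ∸ b₀) +ℚ sumFrom F (b₀ + (b₁ ∸ b₀)) (bₙ ∸ b₁)
    ≡⟨ cong (λ x → sumFrom F b₀ (b₁ ∸ b₀) +ℚ sumFrom F x (bₙ ∸ b₁)) (m+[n∸m]≡n b₀≤b₁) ⟩
  sumFrom F b₀ (b₁ ∸ b₀) +ℚ sumFrom F b₁ (bₙ ∸ b₁)
    ≡⟨ cong (sumFrom F b₀ (b₁ ∸ b₀) +ℚ_) (sumFrom-telescope F r (b ∘ fsuc) (Sorted-tail sorted)) ⟩
  sumFrom F b₀ (b₁ ∸ b₀) +ℚ
    sumFinℚ r (λ k → sumFrom F (b (fsuc (inject₁ k))) (b (fsuc (fsuc k)) ∸ b (fsuc (inject₁ k))))
    ≡⟨ sumFinℚ-suc r (λ k → sumFrom F (b (inject₁ k)) (b (fsuc k) ∸ b (inject₁ k))) ⟨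
  sumFinℚ (suc r) (λ k → sumFrom F (b (inject₁ k)) (b (fsuc k) ∸ b (inject₁ k))) ∎
  where
  open ≡-Reasoning
  b₀ b₁ bₙ : ℕ
  b₀ = b fzero
  b₁ = b (fsuc fzero)
  bₙ = b (fromℕ (suc r))
  b₀≤b₁ : b₀ ≤ b₁
  b₀≤b₁ = sorted fzero (fsuc fzero) z≤n
  b₁≤bₙ : b₁ ≤ bₙ
  b₁≤bₙ = sorted (fsuc fzero) (fromℕ (suc r)) (≤fromℕ (fsuc fzero))

module Layers (p : ℕ) .{{_ : NonZero p}} where

  _/p^_ : ℕ → ℕ → ℚ
  a /p^ n = _/_ (+ a) (p ^ n) {{m^n≢0 p n}}

  layer : (ℕ → ℕ) → ℕ → ℚ
  layer w j = (p ^ w (suc j) ∸ p ^ w j) /p^ suc j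

  1/p^m-expansion : ∀ m A → m ≤ A →
    1 /p^ m ≡ (if does (m ≤? 0) then 1ℚ else 0ℚ) +ℚ
              sumFrom (λ j → if does (m ≟ suc j) then 1 /p^ suc j else 0ℚ) 0 A
  1/p^m-expansion zero A _ =
    sym (trans (cong (1ℚ +ℚ_) (sumFrom-vanish _ A (λ j _ → refl))) (ℚ.+-identityʳ 1ℚ))
  1/p^m-expansion (suc i) A 1+i≤A = sym (begin
    0ℚ +ℚ sumFrom F 0 A   ≡⟨ ℚ.+-identityˡ _ ⟩
    sumFrom F 0 A         ≡⟨ sumFrom-point F i A 1+i≤A F≡0 ⟩
    F i                   ≡⟨ cong (λ b → if b then 1 /p^ suc i else 0ℚ) (dec-true (suc i ≟ suc i) refl) ⟩
    1 /p^ suc i           ∎)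
    where
    open ≡-Reasoning
    F : ℕ → ℚ
    F j = if does (suc i ≟ suc j) then 1 /p^ suc j else 0ℚ
    F≡0 : ∀ j → j ≢ i → F j ≡ 0ℚ
    F≡0 j j≢i =
      cong (λ b → if b then 1 /p^ suc j else 0ℚ) (dec-false (suc i ≟ suc j) (j≢i ∘ sym ∘ suc-injective))

  p^[m+n]∸p^m : ∀ m n → p ^ (m + n) ∸ p ^ m ≡ p ^ m * (p ^ n ∸ 1)
  p^[m+n]∸p^m m n = begin
    p ^ (m + n) ∸ p ^ m          ≡⟨ cong₂ _∸_ (^-distribˡ-+-* p m n) (sym (*-identityʳ (p ^ m))) ⟩
    p ^ m * p ^ n ∸ p ^ m * 1    ≡⟨ *-distribˡ-∸ (p ^ m) (p ^ n) 1 ⟨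
    p ^ m * (p ^ n ∸ 1)          ∎
    where open ≡-Reasoning

  layer-affine : ∀ (w : ℕ → ℕ) s n P L →
    w (P + L) ≡ s + suc n * (P + L) → w (suc (P + L)) ≡ s + suc n * suc (P + L) →
    layer w (P + L) ≡ + (p ^ (n * P + s) * (p ^ suc n ∸ 1) * (p ^ n) ^ L) / p
  layer-affine w s n P L w[j] w[1+j] =
    /-cross (p ^ w (suc j) ∸ p ^ w j) (X * Z * (p ^ n) ^ L) (p ^ suc j) p {{m^n≢0 p (suc j)}} (begin
      (p ^ w (suc j) ∸ p ^ w j) * p
        ≡⟨ cong₂ (λ x y → (p ^ x ∸ p ^ y) * p) (trans w[1+j] (slope s n j)) w[j] ⟩
      (p ^ (e + suc n) ∸ p ^ e) * p
        ≡⟨ cong (_* p) (p^[m+n]∸p^m e (suc n)) ⟩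
      p ^ e * Z * p
        ≡⟨ rearrange₁ (p ^ e) Z p ⟩
      Z * p ^ suc e
        ≡⟨ cong (λ x → Z * p ^ x) (exponent s n P L) ⟩
      Z * p ^ (n * P + s + n * L + suc j)
        ≡⟨ cong (Z *_) (^-distribˡ-+-* p (n * P + s + n * L) (suc j)) ⟩
      Z * (p ^ (n * P + s + n * L) * p ^ suc j)
        ≡⟨ cong (λ x → Z * (x * p ^ suc j)) (^-distribˡ-+-* p (n * P + s) (n * L)) ⟩
      Z * (X * p ^ (n * L) * p ^ suc j)
        ≡⟨ cong (λ x → Z * (X * x * p ^ suc j)) (^-*-assoc p n L) ⟨
      Z * (X * (p ^ n) ^ L * p ^ suc j)
        ≡⟨ rearrange₂ Z X ((p ^ n) ^ L) (p ^ suc j) ⟩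
      X * Z * (p ^ n) ^ L * p ^ suc j ∎)
    where
    open ≡-Reasoning
    j e X Z : ℕ
    j = P + L
    e = s + suc n * j
    X = p ^ (n * P + s)
    Z = p ^ suc n ∸ 1
    slope : ∀ s n j → s + suc n * suc j ≡ (s + suc n * j) + suc n
    slope = solve-∀
    exponent : ∀ s n P L → suc (s + suc n * (P + L)) ≡ n * P + s + n * L + suc (P + L)
    exponent = solve-∀
    rearrange₁ : ∀ x z q → x * z * q ≡ z * (q * x)
    rearrange₁ = solve-∀
    rearrange₂ : ∀ z x y q → z * (x * y * q) ≡ x * z * y * q
    rearrange₂ = solve-∀

  sumFrom-layer-affine : ∀ (w : ℕ → ℕ) s n P L → (∀ t → t ≤ L → w (P + t) ≡ s + suc n * (P + t)) →
    sumFrom (layer w) P L ≡ + (p ^ (n * P + s) * (p ^ suc n ∸ 1) * qint L (p ^ n)) / p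
  sumFrom-layer-affine w s n P zero _ =
    sym (trans (cong (λ x → + x / p) (*-zeroʳ (p ^ (n * P + s) * (p ^ suc n ∸ 1)))) (ℚ.0/n≡0 p))
  sumFrom-layer-affine w s n P (suc L) affine = begin
    sumFrom (layer w) P L +ℚ layer w (P + L)
      ≡⟨ cong₂ _+ℚ_ (sumFrom-layer-affine w s n P L (λ t t≤L → affine t (m≤n⇒m≤1+n t≤L)))
                    (layer-affine w s n P L (affine L (n≤1+n L)) w[P+1+L]) ⟩
    + (c * qint L (p ^ n)) / p +ℚ + (c * (p ^ n) ^ L) / p
      ≡⟨ /-+ (c * qint L (p ^ n)) (c * (p ^ n) ^ L) p ⟩
    + (c * qint L (p ^ n) + c * (p ^ n) ^ L) / p
      ≡⟨ cong (λ x → + x / p) (*-distribˡ-+ c (qint L (p ^ n)) ((p ^ n) ^ L)) ⟨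
    + (c * qint (suc L) (p ^ n)) / p ∎
    where
    open ≡-Reasoning
    c : ℕ
    c = p ^ (n * P + s) * (p ^ suc n ∸ 1)
    w[P+1+L] : w (suc (P + L)) ≡ s + suc n * suc (P + L)
    w[P+1+L] = subst (λ x → w x ≡ s + suc n * x) (+-suc P L) (affine (suc L) ≤-refl)

open Layers using (layer; sumFrom-layer-affine)

module Levels {p : ℕ} (p-prime : Prime p) (r : ℕ) (a : Fin r → ℕ) (A : ℕ) (a≤A : ∀ i → a i ≤ A) where

  private
    instance
      p-nonZero : NonZero p
      p-nonZero = prime⇒nonZero p-prime
      p-nonTrivial : NonTrivial p
      p-nonTrivial = prime⇒nonTrivial p-prime

  open Layers p using (_/p^_; 1/p^m-expansion)

  N : Fin r → ℕ
  N i = p ^ a i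

  ord-power : (g : Tuple r N) → ∃ λ m → m ≤ A × ord r N g ≡ p ^ m
  ord-power g =
    ∣p^n⇒≡p^m p-prime A (Kills⇒ord∣ g (p ^ A) (λ i → ∣m⇒∣m*n (toℕ (g i)) (p^m∣p^n p (a≤A i))))

  level : Tuple r N → ℕ
  level g = proj₁ (ord-power g)

  level≤A : ∀ g → level g ≤ A
  level≤A g = proj₁ (proj₂ (ord-power g))

  ord≡p^level : ∀ g → ord r N g ≡ p ^ level g
  ord≡p^level g = proj₂ (proj₂ (ord-power g))

  isZeroMul≡level≤ : ∀ g j → isZeroMul r N (p ^ j) g ≡ does (level g ≤? j)
  isZeroMul≡level≤ g j = by-cases (level g ≤? j)
    where
    by-cases : (d : Dec (level g ≤ j)) → isZeroMul r N (p ^ j) g ≡ does d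
    by-cases (yes level≤j) = Kills⇒isZeroMul (p ^ j) g
      (ord∣⇒Kills g (p ^ j) (subst (_∣ p ^ j) (sym (ord≡p^level g)) (p^m∣p^n p level≤j)))
    by-cases (no level≰j) = ¬-not λ p^j·g≡0 → level≰j (p^m∣p^n⇒m≤n p
      (subst (_∣ p ^ j) (ord≡p^level g) (Kills⇒ord∣ g (p ^ j) (isZeroMul⇒Kills (p ^ j) g p^j·g≡0))))

  G : List (Tuple r N)
  G = allTuples r N

  count-level≤ : ∀ j → count (λ g → does (level g ≤? j)) G ≡ p ^ Σ⊓ r a j
  count-level≤ j = trans (count-cong (λ g → sym (isZeroMul≡level≤ g j)) G) (count-torsion p r a j)

  count-level≡ : ∀ j → count (λ g → does (level g ≟ suc j)) G ≡ p ^ Σ⊓ r a (suc j) ∸ p ^ Σ⊓ r a j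
  count-level≡ j = trans (sym (m+n∸n≡m _ (count (λ g → does (level g ≤? j)) G)))
    (cong₂ _∸_ (trans (count-≟-suc level j G) (count-level≤ (suc j))) (count-level≤ j))

  δ-layers : δ r N ≡ 1ℚ +ℚ sumFrom (layer p (Σ⊓ r a)) 0 A
  δ-layers = begin
    δ r N
      ≡⟨ sumℚ-cong (λ g → trans (ℚ./-cong {+ 1} {{_}} {{m^n≢0 p (level g)}} refl (ord≡p^level g))
                                 (1/p^m-expansion (level g) A (level≤A g))) G ⟩
    sumℚ (map (λ g → I₀ g +ℚ sumFrom (F g) 0 A) G)
      ≡⟨ sumℚ-+ I₀ (λ g → sumFrom (F g) 0 A) G ⟩
    sumℚ (map I₀ G) +ℚ sumℚ (map (λ g → sumFrom (F g) 0 A) G)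
      ≡⟨ cong₂ _+ℚ_ constant-term (trans (sumℚ-sumFrom F G A) (sumFrom-cong layer-term 0 A)) ⟩
    1ℚ +ℚ sumFrom (layer p (Σ⊓ r a)) 0 A ∎
    where
    open ≡-Reasoning
    I₀ : Tuple r N → ℚ
    I₀ g = if does (level g ≤? 0) then 1ℚ else 0ℚ
    F : Tuple r N → ℕ → ℚ
    F g j = if does (level g ≟ suc j) then 1 /p^ suc j else 0ℚ
    constant-term : sumℚ (map I₀ G) ≡ 1ℚ
    constant-term = trans (sumℚ-if (λ g → does (level g ≤? 0)) 1 G)
      (cong (λ c → + c / 1) (trans (count-level≤ 0) (cong (p ^_) (Σ⊓-zero r a))))
    layer-term : ∀ j → sumℚ (map (λ g → F g j) G) ≡ layer p (Σ⊓ r a) j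
    layer-term j = trans (sumℚ-if (λ g → does (level g ≟ suc j)) (p ^ suc j) {{m^n≢0 p (suc j)}} G)
      (cong (_/p^ suc j) (count-level≡ j))

-- Summing the layers block by block

boundary : ∀ r → (Fin r → ℕ) → Fin (suc r) → ℕ
boundary r a = 0 Vector.∷ a

boundary-sorted : ∀ r (a : Fin r → ℕ) → Sorted r a → Sorted (suc r) (boundary r a)
boundary-sorted r a sorted fzero j _ = z≤n
boundary-sorted r a sorted (fsuc i) (fsuc j) (s≤s i≤j) = sorted i j i≤j

boundary-inject₁ : ∀ r (a : Fin r → ℕ) k → boundary r a (inject₁ k) ≡ prevA r a k
boundary-inject₁ (suc r) a fzero = refl
boundary-inject₁ (suc r) a (fsuc k) = refl

prevA≤a : ∀ r (a : Fin r → ℕ) → Sorted r a → ∀ k → prevA r a k ≤ a k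
prevA≤a (suc r) a sorted fzero = z≤n
prevA≤a (suc r) a sorted (fsuc k) =
  sorted (inject₁ k) (fsuc k) (≤-trans (≤-reflexive (toℕ-inject₁ k)) (n≤1+n (toℕ k)))

n∸i≡suc[n∸suc[i]] : ∀ n (i : Fin n) → n ∸ toℕ i ≡ suc (n ∸ suc (toℕ i))
n∸i≡suc[n∸suc[i]] (suc n) fzero = refl
n∸i≡suc[n∸suc[i]] (suc n) (fsuc i) = n∸i≡suc[n∸suc[i]] n i

sumFrom-layer-block : ∀ p .{{_ : NonZero p}} r (a : Fin r → ℕ) → Sorted r a → ∀ k →
  sumFrom (layer p (Σ⊓ r a)) (prevA r a k) (a k ∸ prevA r a k) ≡
  + (p ^ ((r ∸ suc (toℕ k)) * prevA r a k + sumBelow r a (toℕ k))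
      * (p ^ (r ∸ toℕ k) ∸ 1)
      * qint (a k ∸ prevA r a k) (p ^ (r ∸ suc (toℕ k)))) / p
sumFrom-layer-block p r a sorted k = begin
  sumFrom (layer p (Σ⊓ r a)) P L
    ≡⟨ sumFrom-layer-affine p (Σ⊓ r a) s n P L affine ⟩
  + (p ^ (n * P + s) * (p ^ suc n ∸ 1) * qint L (p ^ n)) / p
    ≡⟨ cong (λ m → + (p ^ (n * P + s) * (p ^ m ∸ 1) * qint L (p ^ n)) / p) (n∸i≡suc[n∸suc[i]] r k) ⟨
  + (p ^ (n * P + s) * (p ^ (r ∸ toℕ k) ∸ 1) * qint L (p ^ n)) / p ∎
  where
  open ≡-Reasoning
  P L s n : ℕ
  P = prevA r a k
  L = a k ∸ P
  s = sumBelow r a (toℕ k)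
  n = r ∸ suc (toℕ k)
  affine : ∀ t → t ≤ L → Σ⊓ r a (P + t) ≡ s + suc n * (P + t)
  affine t t≤L = trans
    (Σ⊓-block r a sorted k (P + t) (m≤m+n P t)
              (subst (P + t ≤_) (m+[n∸m]≡n (prevA≤a r a sorted k)) (+-monoʳ-≤ P t≤L)))
    (cong (λ m → s + m * (P + t)) (n∸i≡suc[n∸suc[i]] r k))

proposition5p5 : (p : ℕ) (pp : Prime p) (r : ℕ) (a : Fin r → ℕ) →
    (∀ i j → i ≤ᶠ j → a i ≤ a j) →
    δ r (λ i → p ^ a i) ≡
      1ℚ +ℚ sumFinℚ r (λ k →
        _/_ (+ (p ^ ((r ∸ suc (toℕ k)) * prevA r a k + sumBelow r a (toℕ k))
               * (p ^ (r ∸ toℕ k) ∸ 1)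
               * qint (a k ∸ prevA r a k) (p ^ (r ∸ suc (toℕ k)))))
            p {{prime⇒nonZero pp}})
proposition5p5 p pp r a sorted = begin
  δ r (λ i → p ^ a i)
    ≡⟨ Levels.δ-layers pp r a aᵣ a≤aᵣ ⟩
  1ℚ +ℚ sumFrom (layer p W) 0 aᵣ
    ≡⟨ cong (1ℚ +ℚ_) (sumFrom-telescope (layer p W) r (boundary r a) (boundary-sorted r a sorted)) ⟩
  1ℚ +ℚ sumFinℚ r (λ k → sumFrom (layer p W) (boundary r a (inject₁ k)) (a k ∸ boundary r a (inject₁ k)))
    ≡⟨ cong (1ℚ +ℚ_) (sumℚ-cong block (allFin r)) ⟩
  1ℚ +ℚ sumFinℚ r (λ k → + (p ^ ((r ∸ suc (toℕ k)) * prevA r a k + sumBelow r a (toℕ k))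
                              * (p ^ (r ∸ toℕ k) ∸ 1)
                              * qint (a k ∸ prevA r a k) (p ^ (r ∸ suc (toℕ k)))) / p) ∎
  where
  open ≡-Reasoning
  instance
    p-nonZero : NonZero p
    p-nonZero = prime⇒nonZero pp
  W : ℕ → ℕ
  W = Σ⊓ r a
  aᵣ : ℕ
  aᵣ = boundary r a (fromℕ r)
  a≤aᵣ : ∀ i → a i ≤ aᵣ
  a≤aᵣ i = boundary-sorted r a sorted (fsuc i) (fromℕ r) (≤fromℕ (fsuc i))
  block : ∀ k → sumFrom (layer p W) (boundary r a (inject₁ k)) (a k ∸ boundary r a (inject₁ k)) ≡
                + (p ^ ((r ∸ suc (toℕ k)) * prevA r a k + sumBelow r a (toℕ k))
                    * (p ^ (r ∸ toℕ k) ∸ 1)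
                    * qint (a k ∸ prevA r a k) (p ^ (r ∸ suc (toℕ k)))) / p
  block k = trans (cong (λ P → sumFrom (layer p W) P (a k ∸ P)) (boundary-inject₁ r a k))
                  (sumFrom-layer-block p r a sorted k)
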